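{- Let $n\ge 5$ be an integer and let $S$ be a packing set of $T^5(n)$. If $|S^5_{1,i}(n)|\le i-1$ for some $i\in\{1,\dots,n-4\}$, then $|S|<n-1$.
   Context: $T(n)$ is the subgraph of the infinite integer grid (vertex set $\mathbb{Z}^2$, $(x,y)\sim(x',y')$ iff $|x-x'|+|y-y'|=1$) induced by $\{(x,y): 1\le x\le y\le n\}$. $T^{5}(n)$ is the subgraph of $T(n)$ induced by the vertices $(x,y)$ of $T(n)$ with $n-4\le y\le n$. For a set $S$ and $1\le i\le n$, $S^5_{1,i}(n)=S\cap\{(x,y)\in V(T(n)): 1\le x\le i,\ n-4\le y\le n\}$. A packing set of a graph $G$ is a set $S\subseteq V(G)$ such that any two distinct $u,v\in S$ satisfy $d_G(u,v)\ge 3$ ($d_G$ the distance in $G$). -}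

module Defs where

open import Data.Nat using (ℕ; zero; suc; _≤_; _∸_; _≤?_; ∣_-_∣)
open import Data.Product using (_×_; _,_; proj₁; proj₂)
open import Data.List using (List; filter)
open import Data.List.Membership.Propositional using (_∈_)
open import Relation.Binary.PropositionalEquality using (_≡_; _≢_)
open import Relation.Nullary.Decidable using (_×-dec_)

-- Points of ℤ² that can occur have positive coordinates, so we use ℕ × ℕ.
Vtx : Set
Vtx = ℕ × ℕ

InT5 : ℕ → Vtx → Set
InT5 n (x , y) = (1 ≤ x) × (x ≤ y) × (y ≤ n) × (n ∸ 4 ≤ y)

Adj : Vtx → Vtx → Set
Adj (x , y) (x' , y') = ∣ x - x' ∣ Data.Nat.+ ∣ y - y' ∣ ≡ 1

data Walk (n : ℕ) : Vtx → Vtx → ℕ → Set where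
  nil  : ∀ {u} → InT5 n u → Walk n u u zero
  cons : ∀ {u w v k} → InT5 n u → Adj u w → Walk n w v k → Walk n u v (suc k)

DistGe3 : ℕ → Vtx → Vtx → Set
DistGe3 n u v = ∀ k → Walk n u v k → 3 ≤ k

-- A finite set S of vertices of T^5(n), given as a duplicate-free list.
-- Packing set of T^5(n).
IsPackingT5 : ℕ → List Vtx → Set
IsPackingT5 n S = ∀ {u v} → u ∈ S → v ∈ S → u ≢ v → DistGe3 n u v

-- S^5_{1,i}(n) = S ∩ {(x,y) ∈ V(T(n)) : 1 ≤ x ≤ i, n-4 ≤ y ≤ n}
-- (membership in V(T(n)) is automatic as S ⊆ V(T^5(n)) ⊆ V(T(n)),
--  but we filter by all stated conditions anyway).
S5 : ℕ → ℕ → List Vtx → List Vtx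
S5 n i S = filter (λ p → (1 ≤? proj₁ p) ×-dec ((proj₁ p ≤? i) ×-dec
                    ((proj₁ p ≤? proj₂ p) ×-dec ((proj₂ p ≤? n) ×-dec (n ∸ 4 ≤? proj₂ p))))) S

module Submission where

-- Write n = 4 + m, so T⁵(n) consists of the rows y = m + r with
-- r ∈ {0,…,4} (the relative row) and x ≤ y; a point in column c therefore has
-- c ≤ r + m.  Since T⁵(n) is ℓ¹-geodesic (any two vertices are joined inside it
-- by a monotone staircase walk), two distinct points of a packing set S are at
-- ℓ¹ distance ≥ 3.  For points in columns c and c + δ with relative rows r, s
-- this reads 3 ≤ δ + |r - s|, and a finite check over r, s ∈ {0,…,4} yields the
-- column structure of S: every column holds at most two points; a full column
-- uses the rows {0,3}, {0,4} or {1,4}, so it lies at c ≤ m + 1, the next column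
-- then holds at most one point, and if it holds one then c ≤ m and column c + 2
-- is empty; the columns ≥ m + 3 together hold at most one point.  A downward
-- induction turns this into the tail bound |{p ∈ S : x ≥ c}| ≤ n - c, and the
-- corollary follows from |S| ≤ |S⁵₁,ᵢ(n)| + |{p ∈ S : x ≥ i + 1}| ≤
-- (i - 1) + (n - i - 1) = n - 2.

open import Defs
open import Data.Nat using (ℕ; zero; suc; _+_; _≤_; _<_; _∸_; _≤?_; _<?_; _≟_; ∣_-_∣; z≤n; s≤s)
open import Data.Nat.Properties
open import Data.Product using (Σ; _×_; _,_; proj₁; proj₂)
open import Data.Sum using (_⊎_; inj₁; inj₂; [_,_])
open import Data.Empty using (⊥; ⊥-elim)
open import Data.List using (List; []; _∷_; length; filter)
open import Data.List.Properties using (filter-all)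
open import Data.List.Membership.Propositional using (_∈_)
open import Data.List.Membership.Propositional.Properties using (∈-filter⁻)
open import Data.List.Relation.Unary.Any using (here; there)
open import Data.List.Relation.Unary.All as All using (All; _∷_)
open import Data.List.Relation.Unary.AllPairs using (_∷_)
open import Data.List.Relation.Unary.Unique.Propositional using (Unique)
open import Data.List.Relation.Unary.Unique.Propositional.Properties using (filter⁺)
open import Relation.Nullary using (Dec; yes; no)
open import Relation.Nullary.Decidable using (from-yes; _×-dec_; _→-dec_; _⊎-dec_)
open import Relation.Unary using (Decidable)
open import Relation.Binary.Definitions using (tri<; tri≈; tri>)
open import Relation.Binary.PropositionalEquality using (_≡_; _≢_; refl; sym; trans; cong; cong₂; subst; subst₂)

∣-∣-stepUp : ∀ {a b} → a < b → ∣ a - b ∣ ≡ suc ∣ suc a - b ∣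
∣-∣-stepUp {zero}  {suc b} _         = refl
∣-∣-stepUp {suc a} {suc b} (s≤s a<b) = ∣-∣-stepUp a<b

∣-∣-stepDown : ∀ {a b} → b ≤ a → ∣ suc a - b ∣ ≡ suc ∣ a - b ∣
∣-∣-stepDown {zero}  {zero}  z≤n       = refl
∣-∣-stepDown {suc a} {zero}  z≤n       = refl
∣-∣-stepDown {suc a} {suc b} (s≤s b≤a) = ∣-∣-stepDown b≤a

∣-∣-offset : ∀ c δ → ∣ c - δ + c ∣ ≡ δ
∣-∣-offset c δ = trans (cong (∣ c -_∣) (+-comm δ c)) (∣m-m+n∣≡n c δ)

∣-∣-shift : ∀ m r s → ∣ r + m - s + m ∣ ≡ ∣ r - s ∣
∣-∣-shift m r s = trans (cong₂ ∣_-_∣ (+-comm r m) (+-comm s m)) (∣m+n-m+o∣≡∣n-o∣ m r s)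

∣-∣-window : ∀ k {a b} → k ≤ a → a ≤ suc k → k ≤ b → b ≤ suc k → ∣ a - b ∣ ≤ 1
∣-∣-window zero {zero}    {zero}    _ _ _ _ = z≤n
∣-∣-window zero {zero}    {suc zero} _ _ _ _ = ≤-refl
∣-∣-window zero {suc zero} {zero}    _ _ _ _ = ≤-refl
∣-∣-window zero {suc zero} {suc zero} _ _ _ _ = z≤n
∣-∣-window zero {suc (suc a)} _ (s≤s ()) _ _
∣-∣-window zero {_} {suc (suc b)} _ _ _ (s≤s ())
∣-∣-window (suc k) (s≤s k≤a) (s≤s a≤k+1) (s≤s k≤b) (s≤s b≤k+1) = ∣-∣-window k k≤a a≤k+1 k≤b b≤k+1

slack : ∀ {c d m} j k → c + d ≡ j + k + m → c ≤ j + m → k ≤ d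
slack {c} {d} {m} j k e c≤j+m = +-cancelˡ-≤ c k d (begin
  c + k         ≤⟨ +-monoˡ-≤ k c≤j+m ⟩
  j + m + k     ≡⟨ +-assoc j m k ⟩
  j + (m + k)   ≡⟨ cong (j +_) (+-comm m k) ⟩
  j + (k + m)   ≡⟨ sym (+-assoc j k m) ⟩
  j + k + m     ≡⟨ sym e ⟩
  c + d         ∎)
  where open ≤-Reasoning

shiftColumn : ∀ k c d {M} → c + (k + d) ≡ M → k + c + d ≡ M
shiftColumn k c d e = trans (cong (_+ d) (+-comm k c)) (trans (+-assoc c k d) e)

dist : Vtx → Vtx → ℕ
dist u v = ∣ proj₁ u - proj₁ v ∣ + ∣ proj₂ u - proj₂ v ∣

dist-self : ∀ u → dist u u ≡ 0
dist-self (a , b) = cong₂ _+_ (∣n-n∣≡0 a) (∣n-n∣≡0 b)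

∣n-1+n∣≡1 : ∀ a → ∣ a - suc a ∣ ≡ 1
∣n-1+n∣≡1 a = trans (∣-∣-stepUp (n<1+n a)) (cong suc (∣n-n∣≡0 a))

∣1+n-n∣≡1 : ∀ a → ∣ suc a - a ∣ ≡ 1
∣1+n-n∣≡1 a = trans (∣-∣-stepDown (≤-refl {a})) (cong suc (∣n-n∣≡0 a))

adjUp : ∀ a b → Adj (a , b) (a , suc b)
adjUp a b = cong₂ _+_ (∣n-n∣≡0 a) (∣n-1+n∣≡1 b)

adjDown : ∀ a b → Adj (a , suc b) (a , b)
adjDown a b = cong₂ _+_ (∣n-n∣≡0 a) (∣1+n-n∣≡1 b)

adjRight : ∀ a b → Adj (a , b) (suc a , b)
adjRight a b = cong₂ _+_ (∣n-1+n∣≡1 a) (∣n-n∣≡0 b)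

adjLeft : ∀ a b → Adj (suc a , b) (a , b)
adjLeft a b = cong₂ _+_ (∣1+n-n∣≡1 a) (∣n-n∣≡0 b)

shortenˡ : ∀ {p p' q k} → p ≡ suc p' → p + q ≡ suc k → p' + q ≡ k
shortenˡ refl e = suc-injective e

shortenʳ : ∀ p {q q' k} → q ≡ suc q' → p + q ≡ suc k → p + q' ≡ k
shortenʳ p refl e = suc-injective (trans (sym (+-suc p _)) e)

-- Greedy route: go up while below the target,
-- then left or right, and finally down (each step stays inside x ≤ y).
geodesic : ∀ {n} k {u v} → dist u v ≡ k → InT5 n u → InT5 n v → Walk n u v k
geodesic zero {a , b} {a' , b'} d iu _
  with ∣m-n∣≡0⇒m≡n {a} {a'} (m+n≡0⇒m≡0 ∣ a - a' ∣ d) | ∣m-n∣≡0⇒m≡n {b} {b'} (m+n≡0⇒n≡0 ∣ a - a' ∣ d)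
... | refl | refl = nil iu
geodesic (suc k) {a , b} {a' , b'} d iu@(1≤a , a≤b , b≤n , lo≤b) iv@(1≤a' , a'≤b' , b'≤n , lo≤b')
  with b <? b'
... | yes b<b' =
  cons iu (adjUp a b) (geodesic k (shortenʳ ∣ a - a' ∣ (∣-∣-stepUp b<b') d)
    (1≤a , m≤n⇒m≤1+n a≤b , ≤-trans b<b' b'≤n , m≤n⇒m≤1+n lo≤b) iv)
... | no b≮b' with <-cmp a a'
...   | tri< a<a' _ _ =
  cons iu (adjRight a b) (geodesic k (shortenˡ (∣-∣-stepUp a<a') d)
    (s≤s z≤n , ≤-trans a<a' (≤-trans a'≤b' (≮⇒≥ b≮b')) , b≤n , lo≤b) iv)
...   | tri> _ _ (s≤s {n = a₀} a'≤a₀) =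
  cons iu (adjLeft a₀ b) (geodesic k (shortenˡ (∣-∣-stepDown a'≤a₀) d)
    (≤-trans 1≤a' a'≤a₀ , ≤-trans (n≤1+n a₀) a≤b , b≤n , lo≤b) iv)
...   | tri≈ _ refl _ with ≤∧≢⇒< (≮⇒≥ b≮b') (λ { refl → 0≢1+n (trans (sym (dist-self (a , b))) d) })
...     | s≤s {n = b₀} b'≤b₀ =
  cons iu (adjDown a b₀) (geodesic k (shortenʳ ∣ a - a ∣ (∣-∣-stepDown b'≤b₀) d)
    (1≤a , ≤-trans a'≤b' b'≤b₀ , ≤-trans (n≤1+n b₀) b≤n , ≤-trans lo≤b' b'≤b₀) iv)

packingSeparated : ∀ {n S u v} → All (InT5 n) S → IsPackingT5 n S →
  u ∈ S → v ∈ S → u ≢ v → 3 ≤ dist u v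
packingSeparated A P u∈S v∈S u≢v =
  P u∈S v∈S u≢v _ (geodesic _ refl (All.lookup A u∈S) (All.lookup A v∈S))

-- Separation of two points whose columns differ by δ and whose relative rows are r and s.
Sep : ℕ → ℕ → ℕ → Set
Sep δ r s = 3 ≤ δ + ∣ r - s ∣

sep? : ∀ δ r s → Dec (Sep δ r s)
sep? δ r s = 3 ≤? δ + ∣ r - s ∣

never : Dec ⊥
never = no λ ()

noThreeInColumn : ∀ {r} → r < 5 → ∀ {s} → s < 5 → ∀ {t} → t < 5 →
  Sep 0 r s → Sep 0 r t → Sep 0 s t → ⊥
noThreeInColumn = from-yes (allUpTo? (λ r → allUpTo? (λ s → allUpTo? (λ t →
  sep? 0 r s →-dec sep? 0 r t →-dec sep? 0 s t →-dec never) 5) 5) 5)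

fullColumnLow : ∀ {r} → r < 5 → ∀ {s} → s < 5 → Sep 0 r s → r ≤ 1 ⊎ s ≤ 1
fullColumnLow = from-yes (allUpTo? (λ r → allUpTo? (λ s →
  sep? 0 r s →-dec (r ≤? 1 ⊎-dec s ≤? 1)) 5) 5)

fullColumnBottom : ∀ {r} → r < 5 → ∀ {s} → s < 5 → ∀ {t} → t < 5 →
  Sep 0 r s → Sep 1 r t → Sep 1 s t → r ≤ 0 ⊎ s ≤ 0
fullColumnBottom = from-yes (allUpTo? (λ r → allUpTo? (λ s → allUpTo? (λ t →
  sep? 0 r s →-dec sep? 1 r t →-dec sep? 1 s t →-dec (r ≤? 0 ⊎-dec s ≤? 0)) 5) 5) 5)

noTwoBesideFull : ∀ {r} → r < 5 → ∀ {s} → s < 5 → ∀ {t} → t < 5 → ∀ {t'} → t' < 5 →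
  Sep 0 r s → Sep 1 r t → Sep 1 s t → Sep 1 r t' → Sep 1 s t' → Sep 0 t t' → ⊥
noTwoBesideFull = from-yes (allUpTo? (λ r → allUpTo? (λ s → allUpTo? (λ t → allUpTo? (λ t' →
  sep? 0 r s →-dec sep? 1 r t →-dec sep? 1 s t →-dec sep? 1 r t' →-dec sep? 1 s t' →-dec
  sep? 0 t t' →-dec never) 5) 5) 5) 5)

noThirdColumn : ∀ {r} → r < 5 → ∀ {s} → s < 5 → ∀ {t} → t < 5 → ∀ {w} → w < 5 →
  Sep 0 r s → Sep 1 r t → Sep 1 s t → Sep 2 r w → Sep 2 s w → Sep 1 t w → ⊥
noThirdColumn = from-yes (allUpTo? (λ r → allUpTo? (λ s → allUpTo? (λ t → allUpTo? (λ w →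
  sep? 0 r s →-dec sep? 1 r t →-dec sep? 1 s t →-dec sep? 2 r w →-dec sep? 2 s w →-dec
  sep? 1 t w →-dec never) 5) 5) 5) 5)

length-filter-∷ : ∀ {A : Set} {P : A → Set} (P? : Decidable P) x xs →
  length (filter P? xs) ≤ length (filter P? (x ∷ xs))
length-filter-∷ P? x xs with P? x
... | yes _ = n≤1+n _
... | no  _ = ≤-refl

length-filter-cover : ∀ {A : Set} {P Q R : A → Set}
  (P? : Decidable P) (Q? : Decidable Q) (R? : Decidable R) →
  (∀ x → P x → Q x ⊎ R x) → ∀ xs →
  length (filter P? xs) ≤ length (filter Q? xs) + length (filter R? xs)
length-filter-cover P? Q? R? cover [] = z≤n
length-filter-cover P? Q? R? cover (x ∷ xs) with ih ← length-filter-cover P? Q? R? cover xs | P? x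
... | no _ = ≤-trans ih (+-mono-≤ (length-filter-∷ Q? x xs) (length-filter-∷ R? x xs))
... | yes px with Q? x
...   | yes _ = s≤s (≤-trans ih (+-monoʳ-≤ _ (length-filter-∷ R? x xs)))
...   | no ¬qx with R? x
...     | yes _ = ≤-trans (s≤s ih) (≤-reflexive (sym (+-suc _ _)))
...     | no ¬rx = ⊥-elim ([ ¬qx , ¬rx ] (cover x px))

pick₁ : ∀ {A : Set} (L : List A) → 1 ≤ length L → Σ A (_∈ L)
pick₁ (x ∷ _) _ = x , here refl

pick₂ : ∀ {A : Set} (L : List A) → Unique L → 2 ≤ length L →
  Σ A λ u → Σ A λ v → u ∈ L × v ∈ L × u ≢ v
pick₂ (x ∷ y ∷ _) ((x≢y ∷ _) ∷ _) _ = x , y , here refl , there (here refl) , x≢y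
pick₂ (_ ∷ []) _ (s≤s ())

pick₃ : ∀ {A : Set} (L : List A) → Unique L → 3 ≤ length L →
  Σ A λ u → Σ A λ v → Σ A λ w → u ∈ L × v ∈ L × w ∈ L × u ≢ v × u ≢ w × v ≢ w
pick₃ (x ∷ y ∷ z ∷ _) ((x≢y ∷ x≢z ∷ _) ∷ (y≢z ∷ _) ∷ _) _ =
  x , y , z , here refl , there (here refl) , there (there (here refl)) , x≢y , x≢z , y≢z
pick₃ (_ ∷ []) _ (s≤s ())
pick₃ (_ ∷ _ ∷ []) _ (s≤s (s≤s ()))

module Columns (m : ℕ) (S : List Vtx) (U : Unique S) (A : All (InT5 (4 + m)) S)
               (P : IsPackingT5 (4 + m) S) where

  inColumn? : ∀ c → Decidable (λ (u : Vtx) → proj₁ u ≡ c)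
  inColumn? c u = proj₁ u ≟ c

  fromColumn? : ∀ c → Decidable (λ (u : Vtx) → c ≤ proj₁ u)
  fromColumn? c u = c ≤? proj₁ u

  count : ℕ → ℕ
  count c = length (filter (inColumn? c) S)

  tail : ℕ → ℕ
  tail c = length (filter (fromColumn? c) S)

  tailSplit : ∀ c → tail c ≤ count c + tail (suc c)
  tailSplit c = length-filter-cover (fromColumn? c) (inColumn? c) (fromColumn? (suc c))
    (λ u c≤x → [ inj₂ , (λ c≡x → inj₁ (sym c≡x)) ] (m≤n⇒m<n∨m≡n c≤x)) S

  record Point (c : ℕ) : Set where
    field
      vertex : Vtx
      member : vertex ∈ S
      column : proj₁ vertex ≡ c

    row : ℕ
    row = proj₂ vertex ∸ m

    -- The point lies at height y = row + m, as y ≥ n - 4 = m.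
    height : row + m ≡ proj₂ vertex
    height = m∸n+n≡m (proj₂ (proj₂ (proj₂ (All.lookup A member))))

    row<5 : row < 5
    row<5 = s≤s (+-cancelʳ-≤ m row 4 (subst (_≤ 4 + m) (sym height)
                  (proj₁ (proj₂ (proj₂ (All.lookup A member))))))

    leftOfRow : ∀ {j} → row ≤ j → c ≤ j + m
    leftOfRow row≤j = ≤-trans (subst₂ _≤_ column (sym height) (proj₁ (proj₂ (All.lookup A member))))
                              (+-monoˡ-≤ m row≤j)

  open Point

  point : ∀ {c u} → u ∈ filter (inColumn? c) S → Point c
  point {c} u∈col = let (u∈S , column) = ∈-filter⁻ (inColumn? c) u∈col
                    in record { vertex = _ ; member = u∈S ; column = column }

  onePoint : ∀ {c} → 1 ≤ count c → Point c
  onePoint {c} one = point (proj₂ (pick₁ _ one))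

  twoPoints : ∀ {c} → 2 ≤ count c → Σ (Point c) λ p → Σ (Point c) λ q → vertex p ≢ vertex q
  twoPoints {c} two =
    let (_ , _ , u∈ , v∈ , u≢v) = pick₂ _ (filter⁺ (inColumn? c) U) two
    in point u∈ , point v∈ , u≢v

  threePoints : ∀ {c} → 3 ≤ count c → Σ (Point c) λ p → Σ (Point c) λ q → Σ (Point c) λ r →
    vertex p ≢ vertex q × vertex p ≢ vertex r × vertex q ≢ vertex r
  threePoints {c} three =
    let (_ , _ , _ , u∈ , v∈ , w∈ , u≢v , u≢w , v≢w) = pick₃ _ (filter⁺ (inColumn? c) U) three
    in point u∈ , point v∈ , point w∈ , u≢v , u≢w , v≢w

  separated : ∀ {c} δ (p : Point c) (q : Point (δ + c)) → vertex p ≢ vertex q → Sep δ (row p) (row q)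
  separated {c} δ p q p≢q =
    subst (3 ≤_) (cong₂ _+_ columnGap rowGap) (packingSeparated A P (member p) (member q) p≢q)
    where
    columnGap : ∣ proj₁ (vertex p) - proj₁ (vertex q) ∣ ≡ δ
    columnGap = trans (cong₂ ∣_-_∣ (column p) (column q)) (∣-∣-offset c δ)
    rowGap : ∣ proj₂ (vertex p) - proj₂ (vertex q) ∣ ≡ ∣ row p - row q ∣
    rowGap = trans (cong₂ ∣_-_∣ (sym (height p)) (sym (height q))) (∣-∣-shift m (row p) (row q))

  separatedʳ : ∀ {c} δ (p : Point c) (q : Point (suc δ + c)) → Sep (suc δ) (row p) (row q)
  separatedʳ δ p q = separated (suc δ) p q λ p≡q →
    m≢1+n+m _ (trans (sym (column p)) (trans (cong proj₁ p≡q) (column q)))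

  atMostTwo : ∀ c → count c ≤ 2
  atMostTwo c = ≮⇒≥ λ three →
    let (p , q , r , p≢q , p≢r , q≢r) = threePoints three
    in noThreeInColumn (row<5 p) (row<5 q) (row<5 r)
         (separated 0 p q p≢q) (separated 0 p r p≢r) (separated 0 q r q≢r)

  fullColumnLeft : ∀ {c} → 2 ≤ count c → c ≤ 1 + m
  fullColumnLeft full =
    let (p , q , p≢q) = twoPoints full
    in [ leftOfRow p , leftOfRow q ] (fullColumnLow (row<5 p) (row<5 q) (separated 0 p q p≢q))

  fullOccupiedLeft : ∀ {c} → 2 ≤ count c → 1 ≤ count (1 + c) → c ≤ 0 + m
  fullOccupiedLeft full occupied =
    let (p , q , p≢q) = twoPoints full ; t = onePoint occupied
    in [ leftOfRow p , leftOfRow q ] (fullColumnBottom (row<5 p) (row<5 q) (row<5 t)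
         (separated 0 p q p≢q) (separatedʳ 0 p t) (separatedʳ 0 q t))

  afterFull : ∀ {c} → 2 ≤ count c → count (1 + c) ≤ 1
  afterFull full = ≮⇒≥ λ two →
    let (p , q , p≢q) = twoPoints full ; (t , t' , t≢t') = twoPoints two
    in noTwoBesideFull (row<5 p) (row<5 q) (row<5 t) (row<5 t')
         (separated 0 p q p≢q) (separatedʳ 0 p t) (separatedʳ 0 q t)
         (separatedʳ 0 p t') (separatedʳ 0 q t') (separated 0 t t' t≢t')

  afterFullOccupied : ∀ {c} → 2 ≤ count c → 1 ≤ count (1 + c) → count (2 + c) ≤ 0
  afterFullOccupied full occupied = ≮⇒≥ λ one →
    let (p , q , p≢q) = twoPoints full ; t = onePoint occupied ; w = onePoint one
    in noThirdColumn (row<5 p) (row<5 q) (row<5 t) (row<5 w)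
         (separated 0 p q p≢q) (separatedʳ 0 p t) (separatedʳ 0 q t)
         (separatedʳ 1 p w) (separatedʳ 1 q w) (separatedʳ 0 t w)

  -- The columns ≥ m + 3 together hold at most one point: their points lie in the
  -- block [m + 3, m + 4]², whose ℓ¹ diameter is 2.
  lastColumnsSparse : tail (3 + m) ≤ 1
  lastColumnsSparse = ≮⇒≥ λ two →
    let (u , v , u∈ , v∈ , u≢v) = pick₂ _ (filter⁺ (fromColumn? (3 + m)) U) two
        (u∈S , mu≤x) = ∈-filter⁻ (fromColumn? (3 + m)) u∈
        (v∈S , mv≤x) = ∈-filter⁻ (fromColumn? (3 + m)) v∈
        (x≤ , my≤ , y≤) = inBlock u∈S mu≤x
        (x'≤ , my'≤ , y'≤) = inBlock v∈S mv≤x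
    in ≤⇒≯ (+-mono-≤ (∣-∣-window (3 + m) mu≤x x≤ mv≤x x'≤) (∣-∣-window (3 + m) my≤ y≤ my'≤ y'≤))
           (packingSeparated A P u∈S v∈S u≢v)
    where
    inBlock : ∀ {u} → u ∈ S → 3 + m ≤ proj₁ u →
      (proj₁ u ≤ 4 + m) × (3 + m ≤ proj₂ u) × (proj₂ u ≤ 4 + m)
    inBlock u∈S m+3≤x =
      let (_ , x≤y , y≤n , _) = All.lookup A u∈S
      in ≤-trans x≤y y≤n , ≤-trans m+3≤x x≤y , y≤n

  -- Tail bound: if c + d = n - 1 then the columns ≥ c hold at most d + 1 = n - c points.
  tailBound : ∀ d c → c + d ≡ 3 + m → tail c ≤ suc d
  tailBound zero c e with trans (sym (+-identityʳ c)) e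
  ... | refl = lastColumnsSparse
  tailBound (suc d) c e with count c ≤? 1
  ... | yes sparse = begin
    tail c                  ≤⟨ tailSplit c ⟩
    count c + tail (1 + c)  ≤⟨ +-mono-≤ sparse (tailBound d (1 + c) (shiftColumn 1 c d e)) ⟩
    1 + suc d               ∎
    where open ≤-Reasoning
  ... | no ¬sparse with slack 1 2 e (fullColumnLeft (≰⇒> ¬sparse))
  ...   | s≤s (s≤s {n = d'} z≤n) with count (1 + c) ≤? 0
  ...     | yes empty = begin
    tail c                                    ≤⟨ tailSplit c ⟩
    count c + tail (1 + c)                    ≤⟨ +-monoʳ-≤ (count c) (tailSplit (1 + c)) ⟩
    count c + (count (1 + c) + tail (2 + c))  ≤⟨ +-mono-≤ (atMostTwo c) (+-mono-≤ empty
                                                   (tailBound d' (2 + c) (shiftColumn 2 c d' e))) ⟩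
    2 + (0 + suc d')                          ∎
    where open ≤-Reasoning
  ...     | no ¬empty with slack 0 3 e (fullOccupiedLeft (≰⇒> ¬sparse) (≰⇒> ¬empty))
  ...       | s≤s (s≤s (s≤s {n = d''} z≤n)) = begin
    tail c                                    ≤⟨ tailSplit c ⟩
    count c + tail (1 + c)                    ≤⟨ +-monoʳ-≤ (count c) (tailSplit (1 + c)) ⟩
    count c + (count (1 + c) + tail (2 + c))  ≤⟨ +-monoʳ-≤ (count c) (+-monoʳ-≤ (count (1 + c)) (tailSplit (2 + c))) ⟩
    count c + (count (1 + c) + (count (2 + c) + tail (3 + c)))
      ≤⟨ +-mono-≤ (atMostTwo c) (+-mono-≤ (afterFull full) (+-mono-≤ (afterFullOccupied full occupied)
           (tailBound d'' (3 + c) (shiftColumn 3 c d'' e)))) ⟩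
    2 + (1 + (0 + suc d''))                   ∎
    where
    open ≤-Reasoning
    full : 2 ≤ count c
    full = ≰⇒> ¬sparse
    occupied : 1 ≤ count (1 + c)
    occupied = ≰⇒> ¬empty

  FirstColumns : ℕ → Vtx → Set
  FirstColumns i u = (1 ≤ proj₁ u) × (proj₁ u ≤ i) × (proj₁ u ≤ proj₂ u) × (proj₂ u ≤ 4 + m) × (m ≤ proj₂ u)

  -- The defining filter of S5, so that S5 (4 + m) i S = filter (firstColumns? i) S.
  firstColumns? : ∀ i → Decidable (FirstColumns i)
  firstColumns? i u = (1 ≤? proj₁ u) ×-dec ((proj₁ u ≤? i) ×-dec ((proj₁ u ≤? proj₂ u) ×-dec
                        ((proj₂ u ≤? 4 + m) ×-dec (4 + m ∸ 4 ≤? proj₂ u))))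

  inT5? : Decidable (InT5 (4 + m))
  inT5? (x , y) = (1 ≤? x) ×-dec ((x ≤? y) ×-dec ((y ≤? 4 + m) ×-dec (m ≤? y)))

  firstColumnsSplit : ∀ i → length S ≤ length (S5 (4 + m) i S) + tail (suc i)
  firstColumnsSplit i = begin
    length S                 ≡⟨ cong length (sym (filter-all inT5? A)) ⟩
    length (filter inT5? S)  ≤⟨ length-filter-cover inT5? (firstColumns? i) (fromColumn? (suc i)) cover S ⟩
    length (S5 (4 + m) i S) + tail (suc i) ∎
    where
    open ≤-Reasoning
    cover : ∀ u → InT5 (4 + m) u → FirstColumns i u ⊎ suc i ≤ proj₁ u
    cover (x , y) (1≤x , x≤y , y≤n , m≤y) with x ≤? i
    ... | yes x≤i = inj₁ (1≤x , x≤i , x≤y , y≤n , m≤y)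
    ... | no  x≰i = inj₂ (≰⇒> x≰i)

corollary3p4 : (n : ℕ) → 5 ≤ n → (S : List Vtx) → Unique S → All (InT5 n) S →
    IsPackingT5 n S → (i : ℕ) → 1 ≤ i → i ≤ n ∸ 4 →
    length (S5 n i S) ≤ i ∸ 1 → length S < n ∸ 1
corollary3p4 (suc (suc (suc (suc (suc k))))) (s≤s (s≤s (s≤s (s≤s (s≤s z≤n))))) S U A P
             (suc i) (s≤s z≤n) i<m firstFew = begin-strict
  length S                                     ≤⟨ firstColumnsSplit (suc i) ⟩
  length (S5 (4 + m) (suc i) S) + tail (2 + i) ≤⟨ +-mono-≤ firstFew (tailBound d (2 + i) e) ⟩
  i + suc d                                    ≡⟨ +-suc i d ⟩
  suc (i + d)                                  <⟨ n<1+n (suc (i + d)) ⟩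
  2 + i + d                                    ≡⟨ e ⟩
  3 + m                                        ∎
  where
  open ≤-Reasoning
  m : ℕ
  m = suc k
  open Columns m S U A P
  -- Column i + 1 lies d columns before the last column n - 1.
  d : ℕ
  d = 3 + m ∸ (2 + i)
  e : 2 + i + d ≡ 3 + m
  e = m+[n∸m]≡n (≤-trans (s≤s i<m) (m≤n+m (suc m) 2))
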